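{- Let $G$ be a polyhedron. Then $A(G)=\{0,1\}$ if and only if $G$ contains no $4$-cycle.
   Context: All graphs are finite, simple and undirected. A polyhedron is a planar $3$-connected graph. $N(u,v)$ is the set of common neighbours of vertices $u,v$, and $A(G)=\{a : \exists \text{ distinct } u,v\in V(G),\ |N(u,v)|=a\}$. -}

module Defs where

open import Data.Nat using (ℕ; _≤_; suc)
open import Data.Bool using (Bool; true; false; _∧_)
open import Data.Fin using (Fin)
open import Data.Fin.Subset using (Subset; _∈_; _∉_; ∣_∣)
open import Data.List using (List; length; filter; map)
open import Data.Fin.Base using () 
open import Data.List using (allFin) renaming (filter to lfilter)
open import Data.Product using (Σ; ∃; _×_; _,_)
open import Data.Sum using (_⊎_)
open import Relation.Nullary using (¬_)
open import Relation.Binary.PropositionalEquality using (_≡_; _≢_)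
open import Data.Bool.Properties using (T?)
open import Data.Bool using (T)
import Data.Rational as Q
open Q using (ℚ; 0ℚ; 1ℚ)

record Graph (n : ℕ) : Set where
  field
    adj   : Fin n → Fin n → Bool
    sym   : ∀ u v → adj u v ≡ adj v u
    irref : ∀ u → adj u u ≡ false
open Graph public

Adj : ∀ {n} → Graph n → Fin n → Fin n → Set
Adj G u v = adj G u v ≡ true

commonNbrs : ∀ {n} → Graph n → Fin n → Fin n → ℕ
commonNbrs {n} G u v = length (lfilter (λ w → T? (adj G u w ∧ adj G v w)) (allFin n))

InA : ∀ {n} → Graph n → ℕ → Set
InA G a = ∃ λ u → ∃ λ v → u ≢ v × commonNbrs G u v ≡ a

AIs01 : ∀ {n} → Graph n → Set
AIs01 G = ∀ a → (InA G a → a ≡ 0 ⊎ a ≡ 1) × ((a ≡ 0 ⊎ a ≡ 1) → InA G a)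

HasC4 : ∀ {n} → Graph n → Set
HasC4 G = ∃ λ a → ∃ λ b → ∃ λ c → ∃ λ d →
  (a ≢ b × a ≢ c × a ≢ d × b ≢ c × b ≢ d × c ≢ d) ×
  (Adj G a b × Adj G b c × Adj G c d × Adj G d a)

data WalkAvoid {n} (G : Graph n) (S : Subset n) : Fin n → Fin n → Set where
  here : ∀ {u} → u ∉ S → WalkAvoid G S u u
  step : ∀ {u v w} → u ∉ S → Adj G u v → WalkAvoid G S v w → WalkAvoid G S u w

ConnectedWithout : ∀ {n} → Graph n → Subset n → Set
ConnectedWithout G S = ∀ u v → u ∉ S → v ∉ S → WalkAvoid G S u v

KConnected : ℕ → ∀ {n} → Graph n → Set
KConnected k {n} G = suc k ≤ n × (∀ (S : Subset n) → suc ∣ S ∣ ≤ k → ConnectedWithout G S)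

-- Planarity (combinatorial surrogate for the topological notion):
-- existence of a straight-line embedding in ℚ² (equivalent to planarity by Fáry's theorem).
Pt : Set
Pt = ℚ × ℚ

interp : Pt → Pt → ℚ → Pt
interp (ax , ay) (bx , by) t = (ax Q.+ t Q.* (bx Q.- ax)) , (ay Q.+ t Q.* (by Q.- ay))

InUnit : ℚ → Set
InUnit t = 0ℚ Q.≤ t × t Q.≤ 1ℚ

OnSegment : Pt → Pt → Pt → Set
OnSegment a b p = ∃ λ t → InUnit t × interp a b t ≡ p

SegmentsMeet : Pt → Pt → Pt → Pt → Set
SegmentsMeet a b c d = ∃ λ t → ∃ λ s → InUnit t × InUnit s × interp a b t ≡ interp c d s

record StraightLineEmbedding {n} (G : Graph n) : Set where
  field
    pos       : Fin n → Pt
    injective : ∀ u v → pos u ≡ pos v → u ≡ v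
    noVertexOnEdge : ∀ u v w → Adj G u v → w ≢ u → w ≢ v → ¬ OnSegment (pos u) (pos v) (pos w)
    noCrossing : ∀ u v x y → Adj G u v → Adj G x y →
      u ≢ x → u ≢ y → v ≢ x → v ≢ y →
      ¬ SegmentsMeet (pos u) (pos v) (pos x) (pos y)

Planar : ∀ {n} → Graph n → Set
Planar G = StraightLineEmbedding G

Polyhedron : ∀ {n} → Graph n → Set
Polyhedron G = Planar G × KConnected 3 G

{-# OPTIONS --safe #-}

-- If A(G) = {0,1}, a 4-cycle w x y z is impossible, since x and z are two common neighbours
-- of w and y. Conversely, without 4-cycles any two vertices have at most one common
-- neighbour, so A(G) ⊆ {0,1}. By 3-connectivity some vertex has two neighbours x, y, and then
-- |N(x,y)| = 1. If no pair had |N(u,v)| = 0, G would be a friendship graph, so by the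
-- friendship theorem it would have a vertex v adjacent to all others; but then in G − v every
-- vertex has at most one neighbour, so G − v, having at least three vertices, is disconnected.
--
-- The friendship theorem is proved by counting: without a universal vertex, nonadjacent
-- vertices have equal degree, so G is k-regular and its adjacency matrix satisfies
-- A² = (k − 1)I + J, whence n = k² − k + 1. For a prime p dividing k − 1 the recurrence
-- A^(m+2) + A^m = kA^m + k^m J shows that the number of closed walks of length p is 1 mod p,
-- while rotating walks, which has no fixed points, shows it is 0 mod p. Hence k ≤ 2 and n ≤ 3.

module Submission where

open import Defs hiding (sym)

open import Data.Bool as Bool using (Bool; true; false; _∧_; if_then_else_)
open import Data.Bool.Properties using (T?; ∧-conicalˡ; ∧-conicalʳ; ∧-idem)
open import Data.Fin as Fin using (Fin; zero; suc)
open import Data.Fin.Properties as Finₚ using (any?; ¬∀⟶∃¬; pigeonhole)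
open import Data.Fin.Subset using (⁅_⁆; _∉_)
open import Data.Fin.Subset.Properties using (∣⁅x⁆∣≡1; x≢y⇒x∉⁅y⁆; x∉⁅y⁆⇒x≢y)
open import Data.List.Relation.Unary.All using (All; []; _∷_)
open import Data.List.Relation.Unary.All.Properties using (¬Any⇒All¬)
open import Data.List.Relation.Unary.Any as Any using (Any)
open import Data.List.Relation.Unary.Any.Properties using (lookup-index)
open import Data.List using (List; []; _∷_; _++_; map; concatMap; length; filter; allFin; lookup)
open import Data.Nat as ℕ using (ℕ; zero; suc; pred; _+_; _*_; _^_; _∸_; _≤_; _<_; z≤n; s≤s; _<?_; NonZero; >-nonZero⁻¹; nonTrivial⇒≢1)
open import Data.Nat.Properties hiding (_≟_)
open import Algebra.Properties.CommutativeSemigroup +-commutativeSemigroup using (interchange)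
open import Data.Nat.Coprimality using (prime⇒coprime; coprime-Bézout)
open import Data.Nat.DivMod using (_%_; _/_; m≡m%n+[m/n]*n; m%n<n)
open import Data.Nat.Divisibility using (_∣_; _∤_; divides; _∣0; ∣m∣n⇒∣m+n; ∣m+n∣m⇒∣n; m∣m*n; ∣1⇒≡1)
open import Data.Nat.GCD using (module Bézout)
open import Data.Nat.Induction using (<-rec)
open import Data.Nat.Primality using (Prime; prime⇒nonZero; prime⇒nonTrivial)
open import Data.Nat.Primality.Factorisation using (factorise)
open import Data.Nat.ListAction using (product)
open import Data.Nat.Solver using (module +-*-Solver)
open import Data.Nat.GeneralisedArithmetic using (fold; fold-+)
open import Data.Empty using (⊥)
open import Data.Product using (∃; ∃₂; _×_; _,_; proj₁; proj₂; map₂)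
open import Data.Sum using (_⊎_; inj₁; inj₂; [_,_]′)
open import Data.Vec using (Vec; []; _∷_; _∷ʳ_; toList)
import Data.Vec.Properties as Vecₚ
import Data.List.Properties as Listₚ
open import Function using (_∘_; id; _⇔_; mk⇔)
open import Relation.Binary.Definitions using (DecidableEquality)
open import Relation.Binary.PropositionalEquality
open import Relation.Nullary using (¬_; Dec; yes; no; does; contradiction; ¬?)
open import Relation.Nullary.Decidable using (dec-true; dec-false; decidable-stable; _×-dec_)

∑ : {A : Set} → List A → (A → ℕ) → ℕ
∑ []       f = 0
∑ (x ∷ xs) f = f x + ∑ xs f

infix 5 ∑
syntax ∑ xs (λ x → e) = ∑[ x ∈ xs ] e

module _ {A : Set} where

  ∑-cong : ∀ xs {f g : A → ℕ} → (∀ x → f x ≡ g x) → ∑ xs f ≡ ∑ xs g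
  ∑-cong []       f≗g = refl
  ∑-cong (x ∷ xs) f≗g = cong₂ _+_ (f≗g x) (∑-cong xs f≗g)

  ∑-mono-≤ : ∀ xs {f g : A → ℕ} → (∀ x → f x ≤ g x) → ∑ xs f ≤ ∑ xs g
  ∑-mono-≤ []       f≤g = z≤n
  ∑-mono-≤ (x ∷ xs) f≤g = +-mono-≤ (f≤g x) (∑-mono-≤ xs f≤g)

  ∑-zero : ∀ (xs : List A) → ∑[ x ∈ xs ] 0 ≡ 0
  ∑-zero []       = refl
  ∑-zero (x ∷ xs) = ∑-zero xs

  ∑-one : ∀ (xs : List A) → ∑[ x ∈ xs ] 1 ≡ length xs
  ∑-one []       = refl
  ∑-one (x ∷ xs) = cong suc (∑-one xs)

  ∑-distrib-+ : ∀ xs (f g : A → ℕ) → ∑[ x ∈ xs ] (f x + g x) ≡ ∑ xs f + ∑ xs g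
  ∑-distrib-+ []       f g = refl
  ∑-distrib-+ (x ∷ xs) f g =
    trans (cong (f x + g x +_) (∑-distrib-+ xs f g)) (interchange (f x) (g x) (∑ xs f) (∑ xs g))

  *-distribˡ-∑ : ∀ c xs (f : A → ℕ) → c * ∑ xs f ≡ ∑[ x ∈ xs ] c * f x
  *-distribˡ-∑ c []       f = *-zeroʳ c
  *-distribˡ-∑ c (x ∷ xs) f =
    trans (*-distribˡ-+ c (f x) (∑ xs f)) (cong (c * f x +_) (*-distribˡ-∑ c xs f))

  *-distribʳ-∑ : ∀ c xs (f : A → ℕ) → ∑ xs f * c ≡ ∑[ x ∈ xs ] f x * c
  *-distribʳ-∑ c []       f = refl
  *-distribʳ-∑ c (x ∷ xs) f =
    trans (*-distribʳ-+ c (f x) (∑ xs f)) (cong (f x * c +_) (*-distribʳ-∑ c xs f))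

  ∑-++ : ∀ xs ys (f : A → ℕ) → ∑ (xs ++ ys) f ≡ ∑ xs f + ∑ ys f
  ∑-++ []       ys f = refl
  ∑-++ (x ∷ xs) ys f = trans (cong (f x +_) (∑-++ xs ys f)) (sym (+-assoc (f x) _ _))

  ∑-positive⇒∃ : ∀ xs (f : A → ℕ) → 0 < ∑ xs f → ∃ λ x → 0 < f x
  ∑-positive⇒∃ (x ∷ xs) f ∑>0 with 0 <? f x
  ... | yes fx>0 = x , fx>0
  ... | no  fx≯0 = ∑-positive⇒∃ xs f (subst (λ m → 0 < m + ∑ xs f) (n≤0⇒n≡0 (≮⇒≥ fx≯0)) ∑>0)

module _ {A B : Set} where

  ∑-map : ∀ (g : A → B) xs (f : B → ℕ) → ∑ (map g xs) f ≡ ∑[ x ∈ xs ] f (g x)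
  ∑-map g []       f = refl
  ∑-map g (x ∷ xs) f = cong (f (g x) +_) (∑-map g xs f)

  ∑-concatMap : ∀ (g : A → List B) xs (f : B → ℕ) → ∑ (concatMap g xs) f ≡ ∑[ x ∈ xs ] ∑ (g x) f
  ∑-concatMap g []       f = refl
  ∑-concatMap g (x ∷ xs) f =
    trans (∑-++ (g x) (concatMap g xs) f) (cong (∑ (g x) f +_) (∑-concatMap g xs f))

  ∑-comm : ∀ xs ys (f : A → B → ℕ) → ∑[ x ∈ xs ] ∑[ y ∈ ys ] f x y ≡ ∑[ y ∈ ys ] ∑[ x ∈ xs ] f x y
  ∑-comm []       ys f = sym (∑-zero ys)
  ∑-comm (x ∷ xs) ys f =
    trans (cong (∑ ys (f x) +_) (∑-comm xs ys f)) (sym (∑-distrib-+ ys (f x) λ y → ∑[ x ∈ xs ] f x y))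

𝟙 : Bool → ℕ
𝟙 true  = 1
𝟙 false = 0

𝟙-∧ : ∀ b c → 𝟙 (b ∧ c) ≡ 𝟙 b * 𝟙 c
𝟙-∧ true  c = sym (+-identityʳ (𝟙 c))
𝟙-∧ false c = refl

𝟙-positive : ∀ {b} → 0 < 𝟙 b → b ≡ true
𝟙-positive {true} _ = refl

length-filter-T? : ∀ {A : Set} (P : A → Bool) xs → length (filter (λ x → T? (P x)) xs) ≡ ∑[ x ∈ xs ] 𝟙 (P x)
length-filter-T? P []       = refl
length-filter-T? P (x ∷ xs) with P x
... | true  = cong suc (length-filter-T? P xs)
... | false = length-filter-T? P xs

record Enumeration (A : Set) : Set where
  field
    _≟_         : DecidableEquality A
    elements    : List A
    occurs-once : ∀ a → ∑[ x ∈ elements ] 𝟙 (does (x ≟ a)) ≡ 1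

module EnumerationSums {A : Set} (E : Enumeration A) where
  open Enumeration E public

  ∑ₑ : (A → ℕ) → ℕ
  ∑ₑ = ∑ elements

  infix 5 ∑ₑ
  syntax ∑ₑ (λ x → e) = ∑ₑ[ x ] e

  δ : A → A → ℕ
  δ a b = 𝟙 (does (a ≟ b))

  δ-refl : ∀ a → δ a a ≡ 1
  δ-refl a = cong 𝟙 (dec-true (a ≟ a) refl)

  δ-≢ : ∀ {a b} → a ≢ b → δ a b ≡ 0
  δ-≢ {a} {b} a≢b = cong 𝟙 (dec-false (a ≟ b) a≢b)

  δ-sym : ∀ a b → δ a b ≡ δ b a
  δ-sym a b with a ≟ b
  ... | yes refl = sym (δ-refl a)
  ... | no  a≢b  = sym (δ-≢ (a≢b ∘ sym))

  ∑-δ : ∀ a → ∑ₑ (δ a) ≡ 1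
  ∑-δ a = trans (∑-cong elements (δ-sym a)) (occurs-once a)

  ∑-δˡ : ∀ a (g : A → ℕ) → ∑ₑ[ x ] δ a x * g x ≡ g a
  ∑-δˡ a g = begin
    ∑ₑ[ x ] δ a x * g x    ≡⟨ ∑-cong elements sift ⟩
    ∑ₑ[ x ] δ x a * g a    ≡⟨ *-distribʳ-∑ (g a) elements (λ x → δ x a) ⟨
    (∑ₑ[ x ] δ x a) * g a  ≡⟨ cong (_* g a) (occurs-once a) ⟩
    1 * g a                ≡⟨ *-identityˡ (g a) ⟩
    g a                    ∎
    where
    open ≡-Reasoning
    sift : ∀ x → δ a x * g x ≡ δ x a * g a
    sift x with x ≟ a
    ... | yes refl = cong (_* g a) (δ-refl a)
    ... | no  x≢a  = cong (_* g x) (δ-≢ (x≢a ∘ sym))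

  ∑-δʳ : ∀ a (g : A → ℕ) → ∑ₑ[ x ] g x * δ x a ≡ g a
  ∑-δʳ a g = trans (∑-cong elements λ x → trans (*-comm (g x) (δ x a)) (cong (_* g x) (δ-sym x a))) (∑-δˡ a g)

  erase : A → (A → ℕ) → A → ℕ
  erase a g x = if does (a ≟ x) then 0 else g x

  erase-≢ : ∀ {a x} (g : A → ℕ) → a ≢ x → erase a g x ≡ g x
  erase-≢ {a} {x} g a≢x rewrite dec-false (a ≟ x) a≢x = refl

  ∑-erase : ∀ a (g : A → ℕ) → ∑ₑ g ≡ ∑ₑ (erase a g) + g a
  ∑-erase a g = begin
    ∑ₑ g                                    ≡⟨ ∑-cong elements split ⟩
    ∑ₑ[ x ] (erase a g x + δ a x * g x)     ≡⟨ ∑-distrib-+ elements (erase a g) (λ x → δ a x * g x) ⟩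
    ∑ₑ (erase a g) + (∑ₑ[ x ] δ a x * g x)  ≡⟨ cong (∑ₑ (erase a g) +_) (∑-δˡ a g) ⟩
    ∑ₑ (erase a g) + g a                    ∎
    where
    open ≡-Reasoning
    split : ∀ x → g x ≡ erase a g x + δ a x * g x
    split x with a ≟ x
    ... | yes refl = sym (+-identityʳ (g a))
    ... | no  _    = sym (+-identityʳ (g x))

  count : (A → Bool) → ℕ
  count P = ∑ₑ[ x ] 𝟙 (P x)

  term≤∑ : ∀ a (g : A → ℕ) → g a ≤ ∑ₑ g
  term≤∑ a g = subst (g a ≤_) (sym (∑-erase a g)) (m≤n+m (g a) _)

  count≥1 : ∀ {P a} → P a ≡ true → 1 ≤ count P
  count≥1 {P} {a} Pa = subst (_≤ count P) (cong 𝟙 Pa) (term≤∑ a (𝟙 ∘ P))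

  count≥2 : ∀ {P a b} → a ≢ b → P a ≡ true → P b ≡ true → 2 ≤ count P
  count≥2 {P} {a} {b} a≢b Pa Pb = begin
    2                                ≡⟨ cong₂ (λ x y → 𝟙 x + 𝟙 y) Pb Pa ⟨
    𝟙 (P b) + 𝟙 (P a)                ≡⟨ cong (_+ 𝟙 (P a)) (erase-≢ (𝟙 ∘ P) a≢b) ⟨
    erase a (𝟙 ∘ P) b + 𝟙 (P a)      ≤⟨ +-monoˡ-≤ (𝟙 (P a)) (term≤∑ b (erase a (𝟙 ∘ P))) ⟩
    ∑ₑ (erase a (𝟙 ∘ P)) + 𝟙 (P a)   ≡⟨ ∑-erase a (𝟙 ∘ P) ⟨
    count P                          ∎
    where open ≤-Reasoning

  ≟-true⇒≡ : ∀ {a b} → does (a ≟ b) ≡ true → a ≡ b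
  ≟-true⇒≡ {a} {b} a≟b with a ≟ b
  ... | yes a≡b = a≡b

  count-positive⇒∃ : ∀ {P} → 1 ≤ count P → ∃ λ x → P x ≡ true
  count-positive⇒∃ {P} count>0 with (x , Px>0) ← ∑-positive⇒∃ elements (𝟙 ∘ P) count>0 = x , 𝟙-positive Px>0

  count≡0 : ∀ {P} → (∀ {x} → P x ≢ true) → count P ≡ 0
  count≡0 ¬P = n≤0⇒n≡0 (≮⇒≥ λ count>0 → ¬P (proj₂ (count-positive⇒∃ count>0)))

  count≤1 : ∀ {P} → (∀ {x y} → P x ≡ true → P y ≡ true → x ≡ y) → count P ≤ 1
  count≤1 {P} unique with 0 <? count P
  ... | no  count≯0 = ≤-trans (≮⇒≥ count≯0) z≤n
  ... | yes count>0 with (x , Px) ← count-positive⇒∃ count>0 = begin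
    count P                         ≡⟨ ∑-erase x (𝟙 ∘ P) ⟩
    ∑ₑ (erase x (𝟙 ∘ P)) + 𝟙 (P x)  ≡⟨ cong (_+ 𝟙 (P x)) (trans (∑-cong elements erased) (∑-zero elements)) ⟩
    𝟙 (P x)                         ≡⟨ cong 𝟙 Px ⟩
    1                               ∎
    where
    open ≤-Reasoning
    erased : ∀ y → erase x (𝟙 ∘ P) y ≡ 0
    erased y with x ≟ y | P y in Py
    ... | yes _  | _     = refl
    ... | no x≢y | true  = contradiction (unique Px Py) x≢y
    ... | no _   | false = refl

  -- Double counting over the fibres of f: each contains at most one x with P x, and none unless it lies over Q.
  count-≤-injection : ∀ {P Q : A → Bool} (f : A → A) →
    (∀ {x} → P x ≡ true → Q (f x) ≡ true) →
    (∀ {x y} → P x ≡ true → P y ≡ true → f x ≡ f y → x ≡ y) →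
    count P ≤ count Q
  count-≤-injection {P} {Q} f maps-into injective = begin
    count P                                ≡⟨ ∑-cong elements spread ⟩
    ∑ₑ[ x ] ∑ₑ[ y ] 𝟙 (P x) * δ (f x) y    ≡⟨ ∑-comm elements elements (λ x y → 𝟙 (P x) * δ (f x) y) ⟩
    ∑ₑ[ y ] ∑ₑ[ x ] 𝟙 (P x) * δ (f x) y    ≤⟨ ∑-mono-≤ elements fibre≤ ⟩
    count Q                                ∎
    where
    open ≤-Reasoning
    spread : ∀ x → 𝟙 (P x) ≡ ∑ₑ[ y ] 𝟙 (P x) * δ (f x) y
    spread x = begin-equality
      𝟙 (P x)                          ≡⟨ *-identityʳ (𝟙 (P x)) ⟨
      𝟙 (P x) * 1                      ≡⟨ cong (𝟙 (P x) *_) (∑-δ (f x)) ⟨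
      𝟙 (P x) * ∑ₑ (δ (f x))           ≡⟨ *-distribˡ-∑ (𝟙 (P x)) elements (δ (f x)) ⟩
      ∑ₑ[ y ] 𝟙 (P x) * δ (f x) y      ∎
    fibre-count≤ : ∀ y → count (λ x → P x ∧ does (f x ≟ y)) ≤ 𝟙 (Q y)
    fibre-count≤ y with Q y in Qy
    ... | true  = count≤1 λ hx hx′ → injective (∧-conicalˡ _ _ hx) (∧-conicalˡ _ _ hx′)
                    (trans (≟-true⇒≡ (∧-conicalʳ _ _ hx)) (sym (≟-true⇒≡ (∧-conicalʳ _ _ hx′))))
    ... | false = ≤-reflexive (count≡0 λ hx →
                    let Qy′ = subst (λ z → Q z ≡ true) (≟-true⇒≡ (∧-conicalʳ _ _ hx)) (maps-into (∧-conicalˡ _ _ hx))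
                    in  contradiction (trans (sym Qy′) Qy) λ ())
    fibre≤ : ∀ y → ∑ₑ[ x ] 𝟙 (P x) * δ (f x) y ≤ 𝟙 (Q y)
    fibre≤ y = subst (_≤ 𝟙 (Q y)) (∑-cong elements λ x → 𝟙-∧ (P x) (does (f x ≟ y))) (fibre-count≤ y)

∑-allFin-suc : ∀ {n} (f : Fin (suc n) → ℕ) → ∑ (allFin (suc n)) f ≡ f zero + ∑ (allFin n) (f ∘ suc)
∑-allFin-suc {n} f = cong (f zero +_) (trans (cong (λ xs → ∑ xs f) (sym (Listₚ.map-tabulate id suc))) (∑-map suc (allFin n) f))

Fin-enumeration : ∀ n → Enumeration (Fin n)
Fin-enumeration n = record { _≟_ = Fin._≟_ ; elements = allFin n ; occurs-once = once }
  where
  once : ∀ {n} (a : Fin n) → ∑[ x ∈ allFin n ] 𝟙 (does (x Fin.≟ a)) ≡ 1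
  once {suc n} zero    = trans (∑-allFin-suc {n} (λ x → 𝟙 (does (x Fin.≟ zero)))) (cong suc (∑-zero (allFin n)))
  once {suc n} (suc a) = trans (∑-allFin-suc {n} (λ x → 𝟙 (does (x Fin.≟ suc a)))) (once a)

vectors : {A : Set} → List A → ∀ m → List (Vec A m)
vectors xs zero    = [] ∷ []
vectors xs (suc m) = concatMap (λ x → map (x ∷_) (vectors xs m)) xs

∑-vectors-suc : ∀ {A : Set} (xs : List A) m (f : Vec A (suc m) → ℕ) →
  ∑ (vectors xs (suc m)) f ≡ ∑[ x ∈ xs ] ∑[ v ∈ vectors xs m ] f (x ∷ v)
∑-vectors-suc xs m f =
  trans (∑-concatMap _ xs f) (∑-cong xs λ x → ∑-map (x ∷_) (vectors xs m) f)

Vec-enumeration : ∀ {A : Set} → Enumeration A → ∀ m → Enumeration (Vec A m)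
Vec-enumeration {A} E m = record
  { _≟_ = Vecₚ.≡-dec _≟_ ; elements = vectors elements m ; occurs-once = once }
  where
  open EnumerationSums E
  once : ∀ {m} (v : Vec A m) → ∑[ u ∈ vectors elements m ] 𝟙 (does (Vecₚ.≡-dec _≟_ u v)) ≡ 1
  once []      = refl
  once {suc m} (a ∷ v) = begin
    ∑[ u ∈ vectors elements (suc m) ] 𝟙 (does (Vecₚ.≡-dec _≟_ u (a ∷ v)))
      ≡⟨ ∑-vectors-suc elements m _ ⟩
    ∑ₑ[ b ] ∑[ u ∈ vectors elements m ] 𝟙 (does (b ≟ a) ∧ does (Vecₚ.≡-dec _≟_ u v))
      ≡⟨ ∑-cong elements (λ b → ∑-cong (vectors elements m) λ u → 𝟙-∧ (does (b ≟ a)) _) ⟩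
    ∑ₑ[ b ] ∑[ u ∈ vectors elements m ] δ b a * 𝟙 (does (Vecₚ.≡-dec _≟_ u v))
      ≡⟨ ∑-cong elements (λ b → *-distribˡ-∑ (δ b a) (vectors elements m) _) ⟨
    ∑ₑ[ b ] δ b a * (∑[ u ∈ vectors elements m ] 𝟙 (does (Vecₚ.≡-dec _≟_ u v)))
      ≡⟨ ∑-cong elements (λ b → trans (cong (δ b a *_) (once v)) (*-identityʳ (δ b a))) ⟩
    ∑ₑ[ b ] δ b a
      ≡⟨ occurs-once a ⟩
    1 ∎
    where open ≡-Reasoning

-- Orbits of prime order

rotate : {A : Set} {m : ℕ} → Vec A (suc m) → Vec A (suc m)
rotate (x ∷ xs) = xs ∷ʳ x

rotate-period : ∀ {A : Set} {m} (v : Vec A (suc m)) → fold v rotate (suc m) ≡ v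
rotate-period {A} {m} v =
  trans (sym (Vecₚ.cast-is-id refl _)) (Vecₚ.toList-injective refl _ v (begin
    toList (fold v rotate (suc m))                  ≡⟨ toList-fold-rotate (suc m) v ⟩
    fold (toList v) rotateList (suc m)              ≡⟨ cong (fold (toList v) rotateList) (Vecₚ.length-toList v) ⟨
    fold (toList v) rotateList (length (toList v))  ≡⟨ cong (λ xs → fold xs rotateList (length (toList v))) (Listₚ.++-identityʳ (toList v)) ⟨
    fold (toList v ++ []) rotateList (length (toList v)) ≡⟨ fold-rotateList-++ (toList v) [] ⟩
    [] ++ toList v                                  ∎))
  where
  open ≡-Reasoning
  rotateList : List A → List A
  rotateList []       = []
  rotateList (x ∷ xs) = xs ++ x ∷ []

  toList-fold-rotate : ∀ {m} j (v : Vec A (suc m)) → toList (fold v rotate j) ≡ fold (toList v) rotateList j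
  toList-fold-rotate zero    v = refl
  toList-fold-rotate (suc j) v with fold v rotate j | toList-fold-rotate j v
  ... | x ∷ xs | eq = trans (Vecₚ.toList-∷ʳ x xs) (cong rotateList eq)

  fold-rotateList-++ : ∀ xs ys → fold (xs ++ ys) rotateList (length xs) ≡ ys ++ xs
  fold-rotateList-++ []       ys = sym (Listₚ.++-identityʳ ys)
  fold-rotateList-++ (x ∷ xs) ys = begin
    fold (x ∷ xs ++ ys) rotateList (suc (length xs))      ≡⟨ cong (fold (x ∷ xs ++ ys) rotateList) (+-comm 1 (length xs)) ⟩
    fold (x ∷ xs ++ ys) rotateList (length xs + 1)        ≡⟨ fold-+ (x ∷ xs ++ ys) rotateList (length xs) ⟩
    fold ((xs ++ ys) ++ x ∷ []) rotateList (length xs)    ≡⟨ cong (λ zs → fold zs rotateList (length xs)) (Listₚ.++-assoc xs ys (x ∷ [])) ⟩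
    fold (xs ++ ys ++ x ∷ []) rotateList (length xs)      ≡⟨ fold-rotateList-++ xs (ys ++ x ∷ []) ⟩
    (ys ++ x ∷ []) ++ xs                                  ≡⟨ Listₚ.++-assoc ys (x ∷ []) xs ⟩
    ys ++ x ∷ xs                                          ∎

-- fold y f d is the d-th iterate of f applied to y.
fold-periodic : ∀ {A : Set} (f : A → A) {y} d a → fold y f d ≡ y → fold y f (a * d) ≡ y
fold-periodic f     d zero    _      = refl
fold-periodic f {y} d (suc a) period = begin
  fold y f (d + a * d)         ≡⟨ fold-+ y f d ⟩
  fold (fold y f (a * d)) f d  ≡⟨ cong (λ z → fold z f d) (fold-periodic f d a period) ⟩
  fold y f d                   ≡⟨ period ⟩
  y                            ∎
  where open ≡-Reasoning

module OrbitCounting {T : Set} (E : Enumeration T) (σ : T → T) {p : ℕ} (p-prime : Prime p)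
                     (σ-period : ∀ x → fold x σ p ≡ x) where
  open EnumerationSums E

  private instance
    p≢0 : NonZero p
    p≢0 = prime⇒nonZero p-prime

  Invariant : (T → ℕ) → Set
  Invariant w = ∀ x → w (σ x) ≡ w x

  VanishesOnFixedPoints : (T → ℕ) → Set
  VanishesOnFixedPoints w = ∀ x → σ x ≡ x → w x ≡ 0

  fold-mod : ∀ x i → fold x σ i ≡ fold x σ (i % p)
  fold-mod x i = begin
    fold x σ i                               ≡⟨ cong (fold x σ) (m≡m%n+[m/n]*n i p) ⟩
    fold x σ (i % p + (i / p) * p)           ≡⟨ fold-+ x σ (i % p) ⟩
    fold (fold x σ ((i / p) * p)) σ (i % p)  ≡⟨ cong (λ y → fold y σ (i % p)) (fold-periodic σ p (i / p) (σ-period x)) ⟩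
    fold x σ (i % p)                         ∎
    where open ≡-Reasoning

  -- By Bézout some multiple of d is congruent to 1 mod p.
  fixed-by-power⇒fixed : ∀ {d y} → 0 < d → d < p → fold y σ d ≡ y → σ y ≡ y
  fixed-by-power⇒fixed {suc d} {y} _ d<p period with coprime-Bézout (prime⇒coprime p-prime d<p)
  ... | Bézout.+- a b 1+b*d≡a*p = begin
    σ y                        ≡⟨ cong σ (fold-periodic σ (suc d) b period) ⟨
    fold y σ (1 + b * suc d)   ≡⟨ cong (fold y σ) 1+b*d≡a*p ⟩
    fold y σ (a * p)           ≡⟨ fold-periodic σ p a (σ-period y) ⟩
    y                          ∎
    where open ≡-Reasoning
  ... | Bézout.-+ a b 1+a*p≡b*d = begin
    σ y                        ≡⟨ cong σ (fold-periodic σ p a (σ-period y)) ⟨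
    fold y σ (1 + a * p)       ≡⟨ cong (fold y σ) 1+a*p≡b*d ⟩
    fold y σ (b * suc d)       ≡⟨ fold-periodic σ (suc d) b period ⟩
    y                          ∎
    where open ≡-Reasoning

  invariant-fold : ∀ {w} → Invariant w → ∀ i x → w (fold x σ i) ≡ w x
  invariant-fold inv zero    x = refl
  invariant-fold inv (suc i) x = trans (inv _) (invariant-fold inv i x)

  module RemoveOrbit (w : T → ℕ) (inv : Invariant w) (vanish : VanishesOnFixedPoints w)
                     (x : T) (wx>0 : 0 < w x) where

    -- Otherwise σⁱ x, of positive weight, would be fixed by σ^(j ∸ i) and hence by σ.
    orbit-injective : ∀ {i j} → i < j → j < p → fold x σ j ≢ fold x σ i
    orbit-injective {i} {j} i<j j<p σʲx≡σⁱx =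
      <⇒≢ wy>0 (sym (vanish y (fixed-by-power⇒fixed (m<n⇒0<n∸m i<j) (≤-<-trans (m∸n≤m j i) j<p) period)))
      where
      y = fold x σ i
      wy>0 : 0 < w y
      wy>0 = subst (0 <_) (sym (invariant-fold inv i x)) wx>0
      period : fold y σ (j ∸ i) ≡ y
      period = trans (sym (fold-+ x σ (j ∸ i))) (trans (cong (fold x σ) (m∸n+n≡m (<⇒≤ i<j))) σʲx≡σⁱx)

    InOrbitBefore : ℕ → T → Set
    InOrbitBefore j v = ∃ λ i → i < j × fold x σ i ≡ v

    inOrbitBefore? : ∀ j v → Dec (InOrbitBefore j v)
    inOrbitBefore? j v = anyUpTo? (λ i → fold x σ i ≟ v) j

    remaining : ℕ → T → ℕ
    remaining j v = if does (inOrbitBefore? j v) then 0 else w v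

    -- inOrbitBefore? (suc j) v is computed by anyUpTo? from exactly these two decisions.
    erase-next : ∀ j v → erase (fold x σ j) (remaining j) v ≡ remaining (suc j) v
    erase-next j v with fold x σ j ≟ v | inOrbitBefore? j v
    ... | yes _ | _     = refl
    ... | no _  | yes _ = refl
    ... | no _  | no _  = refl

    remaining-at-next : ∀ {j} → j < p → remaining j (fold x σ j) ≡ w x
    remaining-at-next {j} j<p
      rewrite dec-false (inOrbitBefore? j (fold x σ j)) (λ (i , i<j , σⁱx≡σʲx) → orbit-injective i<j j<p (sym σⁱx≡σʲx))
      = invariant-fold inv j x

    ∑-remaining : ∀ j → j ≤ p → ∑ₑ w ≡ ∑ₑ (remaining j) + j * w x
    ∑-remaining zero    _      = sym (+-identityʳ (∑ₑ w))
    ∑-remaining (suc j) 1+j≤p = begin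
      ∑ₑ w                                                        ≡⟨ ∑-remaining j (<⇒≤ 1+j≤p) ⟩
      ∑ₑ (remaining j) + j * w x                                  ≡⟨ cong (_+ j * w x) (∑-erase (fold x σ j) (remaining j)) ⟩
      ∑ₑ (erase (fold x σ j) (remaining j)) + remaining j (fold x σ j) + j * w x
        ≡⟨ cong₂ (λ s t → s + t + j * w x) (∑-cong elements (erase-next j)) (remaining-at-next 1+j≤p) ⟩
      ∑ₑ (remaining (suc j)) + w x + j * w x                      ≡⟨ +-assoc (∑ₑ (remaining (suc j))) (w x) (j * w x) ⟩
      ∑ₑ (remaining (suc j)) + suc j * w x                        ∎
      where open ≡-Reasoning

    w′ : T → ℕ
    w′ = remaining p

    ∑-orbit : ∑ₑ w ≡ ∑ₑ w′ + p * w x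
    ∑-orbit = ∑-remaining p ≤-refl

    in-orbit : ∀ i → InOrbitBefore p (fold x σ i)
    in-orbit i = i % p , m%n<n i p , sym (fold-mod x i)

    in-orbit-σ : ∀ {v} → InOrbitBefore p v → InOrbitBefore p (σ v)
    in-orbit-σ (i , _ , refl) = in-orbit (suc i)

    in-orbit-σ⁻ : ∀ {v} → InOrbitBefore p (σ v) → InOrbitBefore p v
    in-orbit-σ⁻ {v} (i , _ , σⁱx≡σv) = subst (InOrbitBefore p) σᵖ⁻¹⁺ⁱx≡v (in-orbit (pred p + i))
      where
      open ≡-Reasoning
      σᵖ⁻¹⁺ⁱx≡v : fold x σ (pred p + i) ≡ v
      σᵖ⁻¹⁺ⁱx≡v = begin
        fold x σ (pred p + i)           ≡⟨ fold-+ x σ (pred p) ⟩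
        fold (fold x σ i) σ (pred p)    ≡⟨ cong (λ y → fold y σ (pred p)) σⁱx≡σv ⟩
        fold (σ v) σ (pred p)           ≡⟨ fold-+ v σ (pred p) ⟨
        fold v σ (pred p + 1)           ≡⟨ cong (fold v σ) (trans (+-comm (pred p) 1) (suc-pred p)) ⟩
        fold v σ p                      ≡⟨ σ-period v ⟩
        v                               ∎

    w′-invariant : Invariant w′
    w′-invariant v with inOrbitBefore? p (σ v) | inOrbitBefore? p v
    ... | yes _  | yes _  = refl
    ... | no  _  | no  _  = inv v
    ... | yes σv | no ¬v  = contradiction (in-orbit-σ⁻ σv) ¬v
    ... | no ¬σv | yes v′ = contradiction (in-orbit-σ v′) ¬σv

    w′-vanishes : VanishesOnFixedPoints w′
    w′-vanishes v σv≡v with inOrbitBefore? p v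
    ... | yes _ = refl
    ... | no  _ = vanish v σv≡v

  p∣∑ : ∀ w → Invariant w → VanishesOnFixedPoints w → p ∣ ∑ₑ w
  p∣∑ w = <-rec Claim remove-an-orbit (∑ₑ w) w refl
    where
    Claim : ℕ → Set
    Claim s = ∀ w → ∑ₑ w ≡ s → Invariant w → VanishesOnFixedPoints w → p ∣ ∑ₑ w
    remove-an-orbit : ∀ s → (∀ {s′} → s′ < s → Claim s′) → Claim s
    remove-an-orbit _ ih w refl inv vanish with 0 <? ∑ₑ w
    ... | no  ∑≯0 = subst (p ∣_) (sym (n≤0⇒n≡0 (≮⇒≥ ∑≯0))) (p ∣0)
    ... | yes ∑>0 with (x , wx>0) ← ∑-positive⇒∃ elements w ∑>0 =
      subst (p ∣_) (sym ∑-orbit) (∣m∣n⇒∣m+n (ih smaller w′ refl w′-invariant w′-vanishes) (m∣m*n (w x)))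
      where
      open RemoveOrbit w inv vanish x wx>0
      smaller : ∑ₑ w′ < ∑ₑ w
      smaller = subst (∑ₑ w′ <_) (sym ∑-orbit) (m<m+n (∑ₑ w′) (*-mono-≤ (>-nonZero⁻¹ p) wx>0))

-- Congruences modulo p

infix 4 _≡1[mod_]

record _≡1[mod_] (x p : ℕ) : Set where
  constructor ≡1-by
  field
    quotient : ℕ
    equality : x ≡ 1 + p * quotient

open _≡1[mod_]

module _ {p : ℕ} where
  open +-*-Solver

  ≡1-* : ∀ {x y} → x ≡1[mod p ] → y ≡1[mod p ] → x * y ≡1[mod p ]
  ≡1-* (≡1-by c refl) (≡1-by d refl) = ≡1-by (c + (1 + p * c) * d) (lemma p c d)
    where
    lemma : ∀ p c d → (1 + p * c) * (1 + p * d) ≡ 1 + p * (c + (1 + p * c) * d)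
    lemma = solve 3 (λ p c d → (con 1 :+ p :* c) :* (con 1 :+ p :* d) := con 1 :+ p :* (c :+ (con 1 :+ p :* c) :* d)) refl

  ≡1-^ : ∀ {x} → x ≡1[mod p ] → ∀ m → x ^ m ≡1[mod p ]
  ≡1-^ _    zero    = ≡1-by 0 (cong suc (sym (*-zeroʳ p)))
  ≡1-^ x≡1 (suc m) = ≡1-* x≡1 (≡1-^ x≡1 m)

  ≡1-+* : ∀ {x} → x ≡1[mod p ] → ∀ y → x + p * y ≡1[mod p ]
  ≡1-+* (≡1-by c refl) y = ≡1-by (c + y) (cong suc (sym (*-distribˡ-+ p c y)))

  ∑-≡1 : ∀ {A : Set} (xs : List A) {f : A → ℕ} → length xs ≡1[mod p ] → (∀ x → f x ≡1[mod p ]) → ∑ xs f ≡1[mod p ]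
  ∑-≡1 xs {f} length≡1 f≡1 = subst (_≡1[mod p ]) (sym (∑≡length+p* xs)) (≡1-+* length≡1 (∑ xs c))
    where
    c : _ → ℕ
    c x = quotient (f≡1 x)
    ∑≡length+p* : ∀ xs → ∑ xs f ≡ length xs + p * ∑ xs c
    ∑≡length+p* []       = sym (*-zeroʳ p)
    ∑≡length+p* (x ∷ xs) = begin
      f x + ∑ xs f                                  ≡⟨ cong₂ _+_ (equality (f≡1 x)) (∑≡length+p* xs) ⟩
      (1 + p * c x) + (length xs + p * ∑ xs c)      ≡⟨ lemma p (c x) (length xs) (∑ xs c) ⟩
      suc (length xs) + p * (c x + ∑ xs c)          ∎
      where
      open ≡-Reasoning
      lemma : ∀ p a l s → (1 + p * a) + (l + p * s) ≡ suc l + p * (a + s)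
      lemma = solve 4 (λ p a l s → (con 1 :+ p :* a) :+ (l :+ p :* s) := (con 1 :+ l) :+ p :* (a :+ s)) refl

  ≡1∧∣⇒∣1 : ∀ {x} → x ≡1[mod p ] → p ∣ x → p ∣ 1
  ≡1∧∣⇒∣1 (≡1-by c refl) p∣x = ∣m+n∣m⇒∣n (subst (p ∣_) (+-comm 1 (p * c)) p∣x) (m∣m*n c)

prime∤1 : ∀ {p} → Prime p → p ∤ 1
prime∤1 p-prime p∣1 = nonTrivial⇒≢1 {{prime⇒nonTrivial p-prime}} (∣1⇒≡1 p∣1)

∃-prime-factor : ∀ m → ∃ λ p → Prime p × p ∣ 2 + m
∃-prime-factor m with factorise (2 + m)
... | record { factors = [] ; isFactorisation = () }
... | record { factors = p ∷ ps ; isFactorisation = 2+m≡product ; factorsPrime = p-prime ∷ _ } =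
  p , p-prime , subst (p ∣_) (sym 2+m≡product) (m∣m*n (product ps))

≢1-mod-primes⇒≤2 : ∀ k → (∀ {p} → Prime p → ¬ (k ≡1[mod p ])) → k ≤ 2
≢1-mod-primes⇒≤2 0       _ = z≤n
≢1-mod-primes⇒≤2 1       _ = s≤s z≤n
≢1-mod-primes⇒≤2 2       _ = s≤s (s≤s z≤n)
≢1-mod-primes⇒≤2 (suc (suc (suc m))) ¬≡1 with p , p-prime , divides q 2+m≡q*p ← ∃-prime-factor m =
  contradiction (≡1-by q (cong suc (trans 2+m≡q*p (*-comm q p)))) (¬≡1 p-prime)

UniqueCommonNeighbours : ∀ {n} → Graph n → Set
UniqueCommonNeighbours G = ∀ {u v x y} → u ≢ v → Adj G u x → Adj G v x → Adj G u y → Adj G v y → x ≡ y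

IsFriendshipGraph : ∀ {n} → Graph n → Set
IsFriendshipGraph G = ∀ {u v} → u ≢ v → commonNbrs G u v ≡ 1

Universal : ∀ {n} → Graph n → Fin n → Set
Universal G v = ∀ {x} → x ≢ v → Adj G v x

NoCutVertex : ∀ {n} → Graph n → Set
NoCutVertex G = ∀ v → ConnectedWithout G ⁅ v ⁆

module GraphCounting {n : ℕ} (G : Graph n) where
  open EnumerationSums (Fin-enumeration n) public

  Adj? : ∀ u v → Dec (Adj G u v)
  Adj? u v = adj G u v Bool.≟ true

  Adj-sym : ∀ {u v} → Adj G u v → Adj G v u
  Adj-sym {u} {v} u~v = trans (Graph.sym G v u) u~v

  Adj⇒≢ : ∀ {u v} → Adj G u v → u ≢ v
  Adj⇒≢ {u} u~u refl = contradiction (trans (sym (irref G u)) u~u) λ ()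

  A : Fin n → Fin n → ℕ
  A u v = 𝟙 (adj G u v)

  A-sym : ∀ u v → A u v ≡ A v u
  A-sym u v = cong 𝟙 (Graph.sym G u v)

  A-irrefl : ∀ u → A u u ≡ 0
  A-irrefl u = cong 𝟙 (irref G u)

  degree : Fin n → ℕ
  degree u = count (adj G u)

  common : Fin n → Fin n → ℕ
  common u v = count λ x → adj G u x ∧ adj G v x

  commonNbrs≡common : ∀ u v → commonNbrs G u v ≡ common u v
  commonNbrs≡common u v = length-filter-T? (λ x → adj G u x ∧ adj G v x) (allFin n)

  common≥1 : ∀ {u v x} → Adj G u x → Adj G v x → 1 ≤ common u v
  common≥1 u~x v~x = count≥1 (cong₂ _∧_ u~x v~x)

  common≥2 : ∀ {u v x y} → x ≢ y → Adj G u x → Adj G v x → Adj G u y → Adj G v y → 2 ≤ common u v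
  common≥2 x≢y u~x v~x u~y v~y = count≥2 x≢y (cong₂ _∧_ u~x v~x) (cong₂ _∧_ u~y v~y)

  unique⇒common≤1 : UniqueCommonNeighbours G → ∀ {u v} → u ≢ v → common u v ≤ 1
  unique⇒common≤1 unique u≢v = count≤1 λ ux∧vx uy∧vy →
    unique u≢v (∧-conicalˡ _ _ ux∧vx) (∧-conicalʳ _ _ ux∧vx) (∧-conicalˡ _ _ uy∧vy) (∧-conicalʳ _ _ uy∧vy)

  C4-free⇒unique : ¬ HasC4 G → UniqueCommonNeighbours G
  C4-free⇒unique ¬C4 {u} {v} {x} {y} u≢v u~x v~x u~y v~y with x ≟ y
  ... | yes x≡y = x≡y
  ... | no  x≢y = contradiction
    (u , x , v , y , (Adj⇒≢ u~x , u≢v , Adj⇒≢ u~y , Adj⇒≢ (Adj-sym v~x) , x≢y , Adj⇒≢ v~y) ,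
                     (u~x , Adj-sym v~x , v~y , Adj-sym u~y))
    ¬C4

  AIs01⇒C4-free : AIs01 G → ¬ HasC4 G
  AIs01⇒C4-free A≡01 (w , x , y , z , (_ , w≢y , _ , _ , x≢z , _) , (w~x , x~y , y~z , z~w)) =
    <⇒≱ (common≥2 x≢z w~x (Adj-sym x~y) (Adj-sym z~w) y~z) common≤1
    where
    common≤1 : common w y ≤ 1
    common≤1 with proj₁ (A≡01 (commonNbrs G w y)) (w , y , w≢y , refl)
    ... | inj₁ ≡0 = subst (_≤ 1) (trans (sym ≡0) (commonNbrs≡common w y)) z≤n
    ... | inj₂ ≡1 = subst (_≤ 1) (trans (sym ≡1) (commonNbrs≡common w y)) ≤-refl

  walks : ℕ → Fin n → Fin n → ℕ
  walks zero    u v = δ u v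
  walks (suc m) u v = ∑ₑ[ x ] A u x * walks m x v

  path-weight : ∀ {m} → Fin n → Vec (Fin n) m → Fin n → ℕ
  path-weight s []       t = A s t
  path-weight s (x ∷ xs) t = A s x * path-weight x xs t

  closed-walk-weight : ∀ {m} → Vec (Fin n) (suc m) → ℕ
  closed-walk-weight (x ∷ xs) = path-weight x xs x

  ∑-path-weight : ∀ m s t → ∑[ xs ∈ vectors (allFin n) m ] path-weight s xs t ≡ walks (suc m) s t
  ∑-path-weight zero    s t = trans (+-identityʳ (A s t)) (sym (∑-δʳ t (A s)))
  ∑-path-weight (suc m) s t = begin
    ∑[ xs ∈ vectors (allFin n) (suc m) ] path-weight s xs t
      ≡⟨ ∑-vectors-suc (allFin n) m (λ xs → path-weight s xs t) ⟩
    ∑ₑ[ x ] ∑[ xs ∈ vectors (allFin n) m ] A s x * path-weight x xs t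
      ≡⟨ ∑-cong elements (λ x → *-distribˡ-∑ (A s x) (vectors (allFin n) m) _) ⟨
    ∑ₑ[ x ] A s x * (∑[ xs ∈ vectors (allFin n) m ] path-weight x xs t)
      ≡⟨ ∑-cong elements (λ x → cong (A s x *_) (∑-path-weight m x t)) ⟩
    walks (suc (suc m)) s t ∎
    where open ≡-Reasoning

  ∑-closed-walk-weight : ∀ m → ∑[ v ∈ vectors (allFin n) (suc m) ] closed-walk-weight v ≡ ∑ₑ[ u ] walks (suc m) u u
  ∑-closed-walk-weight m =
    trans (∑-vectors-suc (allFin n) m closed-walk-weight) (∑-cong elements λ u → ∑-path-weight m u u)

  path-weight-∷ʳ : ∀ {m} s (xs : Vec (Fin n) m) y t → path-weight s (xs ∷ʳ y) t ≡ path-weight s xs y * A y t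
  path-weight-∷ʳ s []       y t = refl
  path-weight-∷ʳ s (x ∷ xs) y t =
    trans (cong (A s x *_) (path-weight-∷ʳ x xs y t)) (sym (*-assoc (A s x) (path-weight x xs y) (A y t)))

  closed-walk-weight-rotate : ∀ {m} (v : Vec (Fin n) (suc m)) → closed-walk-weight (rotate v) ≡ closed-walk-weight v
  closed-walk-weight-rotate (x ∷ [])     = refl
  closed-walk-weight-rotate (x ∷ y ∷ ys) = trans (path-weight-∷ʳ y ys x y) (*-comm (path-weight y ys x) (A x y))

  closed-walk-weight-fixed : ∀ {m} (v : Vec (Fin n) (suc m)) → rotate v ≡ v → closed-walk-weight v ≡ 0
  closed-walk-weight-fixed (x ∷ [])     _ = A-irrefl x
  closed-walk-weight-fixed (x ∷ y ∷ ys) rotate-v≡v with Vecₚ.∷-injectiveˡ rotate-v≡v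
  ... | refl = cong (_* path-weight y ys y) (A-irrefl y)

-- The friendship theorem

module Friendship {n : ℕ} (G : Graph n) (friends : IsFriendshipGraph G) where
  open GraphCounting G

  common≡1 : ∀ {u v} → u ≢ v → common u v ≡ 1
  common≡1 {u} {v} u≢v = trans (sym (commonNbrs≡common u v)) (friends u≢v)

  unique : UniqueCommonNeighbours G
  unique {u} {v} {x} {y} u≢v u~x v~x u~y v~y with x ≟ y
  ... | yes x≡y = x≡y
  ... | no  x≢y = contradiction (subst (2 ≤_) (common≡1 u≢v) (common≥2 x≢y u~x v~x u~y v~y)) λ { (s≤s ()) }

  -- The common neighbour of u and v; junk (u itself) when u ≡ v.
  meet : Fin n → Fin n → Fin n
  meet u v with any? (λ x → (adj G u x ∧ adj G v x) Bool.≟ true)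
  ... | yes (x , _) = x
  ... | no  _       = u

  meet-adj : ∀ {u v} → u ≢ v → Adj G u (meet u v) × Adj G v (meet u v)
  meet-adj {u} {v} u≢v with any? (λ x → (adj G u x ∧ adj G v x) Bool.≟ true)
  ... | yes (x , u~x∧v~x) = ∧-conicalˡ _ _ u~x∧v~x , ∧-conicalʳ _ _ u~x∧v~x
  ... | no  ∄             = contradiction (count-positive⇒∃ (≤-reflexive (sym (common≡1 u≢v)))) ∄

  nonadjacent⇒degree≤ : ∀ {u w} → u ≢ w → ¬ Adj G u w → degree u ≤ degree w
  nonadjacent⇒degree≤ {u} {w} u≢w u≁w = count-≤-injection (λ x → meet x w) maps-into injective
    where
    ≢w : ∀ {x} → Adj G u x → x ≢ w
    ≢w u~x refl = u≁w u~x
    maps-into : ∀ {x} → Adj G u x → Adj G w (meet x w)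
    maps-into u~x = proj₂ (meet-adj (≢w u~x))
    injective : ∀ {x x′} → Adj G u x → Adj G u x′ → meet x w ≡ meet x′ w → x ≡ x′
    injective {x} {x′} u~x u~x′ same with x ≟ x′
    ... | yes x≡x′ = x≡x′
    ... | no  x≢x′ = contradiction (subst (Adj G w) (sym u≡meet) (maps-into u~x)) (u≁w ∘ Adj-sym)
      where
      u≡meet : u ≡ meet x w
      u≡meet = unique x≢x′ (Adj-sym u~x) (Adj-sym u~x′)
                 (proj₁ (meet-adj (≢w u~x))) (subst (Adj G x′) (sym same) (proj₁ (meet-adj (≢w u~x′))))

  nonadjacent⇒same-degree : ∀ {u w} → u ≢ w → ¬ Adj G u w → degree u ≡ degree w
  nonadjacent⇒same-degree u≢w u≁w =
    ≤-antisym (nonadjacent⇒degree≤ u≢w u≁w) (nonadjacent⇒degree≤ (u≢w ∘ sym) (u≁w ∘ Adj-sym))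

  different-degrees⇒adjacent : ∀ {u w x} → degree u ≢ degree w → x ≢ u → x ≢ w → Adj G u x ⊎ Adj G w x
  different-degrees⇒adjacent {u} {w} {x} du≢dw x≢u x≢w with Adj? u x | Adj? w x
  ... | yes u~x | _       = inj₁ u~x
  ... | no  _   | yes w~x = inj₂ w~x
  ... | no  u≁x | no  w≁x = contradiction
    (trans (sym (nonadjacent⇒same-degree x≢u (u≁x ∘ Adj-sym))) (nonadjacent⇒same-degree x≢w (w≁x ∘ Adj-sym))) du≢dw

  -- A vertex x ≠ u not adjacent to u is, by the degree conditions, adjacent to w and to z,
  -- so it would be a second common neighbour of w and z besides u.
  different-degrees⇒universal : ∀ {u w z} → Adj G u w → degree u ≢ degree w →
    Adj G u z → Adj G w z → degree z ≢ degree u → Universal G u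
  different-degrees⇒universal {u} {w} {z} u~w du≢dw u~z w~z dz≢du {x} x≢u with x ≟ w | x ≟ z | Adj? u x
  ... | yes refl | _        | _       = u~w
  ... | no _     | yes refl | _       = u~z
  ... | no _     | no _     | yes u~x = u~x
  ... | no x≢w   | no x≢z   | no u≁x
    with different-degrees⇒adjacent du≢dw x≢u x≢w | different-degrees⇒adjacent dz≢du x≢z x≢u
  ... | inj₁ u~x | _        = contradiction u~x u≁x
  ... | _        | inj₂ u~x = contradiction u~x u≁x
  ... | inj₂ w~x | inj₁ z~x = contradiction (unique (Adj⇒≢ w~z) w~x z~x (Adj-sym u~w) (Adj-sym u~z)) x≢u

  no-universal⇒regular : (∀ v → ¬ Universal G v) → ∀ u w → degree u ≡ degree w
  no-universal⇒regular ¬universal u w with u ≟ w | Adj? u w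
  ... | yes refl | _       = refl
  ... | no  u≢w  | no u≁w  = nonadjacent⇒same-degree u≢w u≁w
  ... | no  u≢w  | yes u~w = decidable-stable (degree u ℕ.≟ degree w) adjacent-case
    where
    adjacent-case : degree u ≢ degree w → ⊥
    adjacent-case du≢dw with meet-adj u≢w | degree (meet u w) ℕ.≟ degree u
    ... | u~z , w~z | no  dz≢du = ¬universal u (different-degrees⇒universal u~w du≢dw u~z w~z dz≢du)
    ... | u~z , w~z | yes dz≡du = ¬universal w
      (different-degrees⇒universal (Adj-sym u~w) (du≢dw ∘ sym) w~z u~z (du≢dw ∘ trans (sym dz≡du)))

module RegularFriendship {n : ℕ} (G : Graph n) (friends : IsFriendshipGraph G)
                         (k : ℕ) (regular : ∀ u → GraphCounting.degree G u ≡ k) where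
  open GraphCounting G
  open Friendship G friends using (common≡1)
  open +-*-Solver

  A²≡common : ∀ u v → ∑ₑ[ x ] A u x * A x v ≡ common u v
  A²≡common u v = ∑-cong elements λ x → trans (cong (A u x *_) (A-sym x v)) (sym (𝟙-∧ (adj G u x) (adj G v x)))

  A²+I≡kI+J : ∀ u v → (∑ₑ[ x ] A u x * A x v) + δ u v ≡ k * δ u v + 1
  A²+I≡kI+J u v with u ≟ v
  ... | yes refl = begin
    (∑ₑ[ x ] A u x * A x u) + 1  ≡⟨ cong (_+ 1) (A²≡common u u) ⟩
    common u u + 1               ≡⟨ cong (_+ 1) (∑-cong elements λ x → cong 𝟙 (∧-idem (adj G u x))) ⟩
    degree u + 1                 ≡⟨ cong (_+ 1) (trans (regular u) (sym (*-identityʳ k))) ⟩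
    k * 1 + 1                    ∎
    where open ≡-Reasoning
  ... | no u≢v = begin
    (∑ₑ[ x ] A u x * A x v) + 0  ≡⟨ +-identityʳ _ ⟩
    ∑ₑ[ x ] A u x * A x v        ≡⟨ A²≡common u v ⟩
    common u v                   ≡⟨ common≡1 u≢v ⟩
    1                            ≡⟨ cong (_+ 1) (*-zeroʳ k) ⟨
    k * 0 + 1                    ∎
    where open ≡-Reasoning

  column-sum-A : ∀ x → ∑ₑ[ u ] A u x ≡ k
  column-sum-A x = trans (∑-cong elements λ u → A-sym u x) (regular x)

  vertex-count : Fin n → k * k + 1 ≡ k + n
  vertex-count u = begin
    k * k + 1                                                 ≡⟨ cong (_+ 1) row-sum-A² ⟨
    (∑ₑ[ v ] ∑ₑ[ x ] A u x * A x v) + 1                       ≡⟨ cong ((∑ₑ[ v ] ∑ₑ[ x ] A u x * A x v) +_) (∑-δ u) ⟨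
    (∑ₑ[ v ] ∑ₑ[ x ] A u x * A x v) + ∑ₑ (δ u)                ≡⟨ ∑-distrib-+ elements _ (δ u) ⟨
    ∑ₑ[ v ] ((∑ₑ[ x ] A u x * A x v) + δ u v)                 ≡⟨ ∑-cong elements (A²+I≡kI+J u) ⟩
    ∑ₑ[ v ] (k * δ u v + 1)                                   ≡⟨ ∑-distrib-+ elements (λ v → k * δ u v) (λ _ → 1) ⟩
    (∑ₑ[ v ] k * δ u v) + (∑ₑ[ v ] 1)                         ≡⟨ cong₂ _+_ (*-distribˡ-∑ k elements (δ u)) (sym (∑-one elements)) ⟨
    k * ∑ₑ (δ u) + length (allFin n)                          ≡⟨ cong₂ (λ s l → k * s + l) (∑-δ u) (Listₚ.length-tabulate id) ⟩
    k * 1 + n                                                 ≡⟨ cong (_+ n) (*-identityʳ k) ⟩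
    k + n                                                     ∎
    where
    open ≡-Reasoning
    row-sum-A² : (∑ₑ[ v ] ∑ₑ[ x ] A u x * A x v) ≡ k * k
    row-sum-A² = begin
      ∑ₑ[ v ] ∑ₑ[ x ] A u x * A x v     ≡⟨ ∑-comm elements elements (λ v x → A u x * A x v) ⟩
      ∑ₑ[ x ] ∑ₑ[ v ] A u x * A x v     ≡⟨ ∑-cong elements (λ x → *-distribˡ-∑ (A u x) elements (A x)) ⟨
      ∑ₑ[ x ] A u x * degree x          ≡⟨ ∑-cong elements (λ x → cong (A u x *_) (regular x)) ⟩
      ∑ₑ[ x ] A u x * k                 ≡⟨ *-distribʳ-∑ k elements (A u) ⟨
      degree u * k                      ≡⟨ cong (_* k) (regular u) ⟩
      k * k                             ∎

  walks-column-sum : ∀ m v → ∑ₑ[ u ] walks m u v ≡ k ^ m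
  walks-column-sum zero    v = occurs-once v
  walks-column-sum (suc m) v = begin
    ∑ₑ[ u ] ∑ₑ[ x ] A u x * walks m x v     ≡⟨ ∑-comm elements elements (λ u x → A u x * walks m x v) ⟩
    ∑ₑ[ x ] ∑ₑ[ u ] A u x * walks m x v     ≡⟨ ∑-cong elements (λ x → *-distribʳ-∑ (walks m x v) elements (λ u → A u x)) ⟨
    ∑ₑ[ x ] (∑ₑ[ u ] A u x) * walks m x v   ≡⟨ ∑-cong elements (λ x → cong (_* walks m x v) (column-sum-A x)) ⟩
    ∑ₑ[ x ] k * walks m x v                 ≡⟨ *-distribˡ-∑ k elements (λ x → walks m x v) ⟨
    k * (∑ₑ[ x ] walks m x v)               ≡⟨ cong (k *_) (walks-column-sum m v) ⟩
    k * k ^ m                               ∎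
    where open ≡-Reasoning

  walks-2+ : ∀ m u v → walks (2 + m) u v ≡ ∑ₑ[ y ] (∑ₑ[ x ] A u x * A x y) * walks m y v
  walks-2+ m u v = begin
    ∑ₑ[ x ] A u x * (∑ₑ[ y ] A x y * walks m y v)     ≡⟨ ∑-cong elements (λ x → *-distribˡ-∑ (A u x) elements _) ⟩
    ∑ₑ[ x ] ∑ₑ[ y ] A u x * (A x y * walks m y v)     ≡⟨ ∑-comm elements elements _ ⟩
    ∑ₑ[ y ] ∑ₑ[ x ] A u x * (A x y * walks m y v)     ≡⟨ ∑-cong elements (λ y → ∑-cong elements λ x → *-assoc (A u x) (A x y) _) ⟨
    ∑ₑ[ y ] ∑ₑ[ x ] A u x * A x y * walks m y v       ≡⟨ ∑-cong elements (λ y → *-distribʳ-∑ (walks m y v) elements _) ⟨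
    ∑ₑ[ y ] (∑ₑ[ x ] A u x * A x y) * walks m y v     ∎
    where open ≡-Reasoning

  walks-recurrence : ∀ m u v → walks (2 + m) u v + walks m u v ≡ k * walks m u v + k ^ m
  walks-recurrence m u v = begin
    walks (2 + m) u v + walks m u v
      ≡⟨ cong₂ _+_ (walks-2+ m u v) (sym (∑-δˡ u (λ y → walks m y v))) ⟩
    (∑ₑ[ y ] (∑ₑ[ x ] A u x * A x y) * walks m y v) + (∑ₑ[ y ] δ u y * walks m y v)
      ≡⟨ ∑-distrib-+ elements _ _ ⟨
    ∑ₑ[ y ] ((∑ₑ[ x ] A u x * A x y) * walks m y v + δ u y * walks m y v)
      ≡⟨ ∑-cong elements (λ y → *-distribʳ-+ (walks m y v) (∑ₑ[ x ] A u x * A x y) (δ u y)) ⟨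
    ∑ₑ[ y ] ((∑ₑ[ x ] A u x * A x y) + δ u y) * walks m y v
      ≡⟨ ∑-cong elements (λ y → cong (_* walks m y v) (A²+I≡kI+J u y)) ⟩
    ∑ₑ[ y ] (k * δ u y + 1) * walks m y v
      ≡⟨ ∑-cong elements (λ y → lemma k (δ u y) (walks m y v)) ⟩
    ∑ₑ[ y ] (k * (δ u y * walks m y v) + walks m y v)
      ≡⟨ ∑-distrib-+ elements _ _ ⟩
    (∑ₑ[ y ] k * (δ u y * walks m y v)) + (∑ₑ[ y ] walks m y v)
      ≡⟨ cong₂ _+_ (trans (sym (*-distribˡ-∑ k elements _)) (cong (k *_) (∑-δˡ u (λ y → walks m y v)))) (walks-column-sum m v) ⟩
    k * walks m u v + k ^ m ∎
    where
    open ≡-Reasoning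
    lemma : ∀ k d w → (k * d + 1) * w ≡ k * (d * w) + w
    lemma = solve 3 (λ k d w → (k :* d :+ con 1) :* w := k :* (d :* w) :+ w) refl

  module _ {p : ℕ} (k≡1 : k ≡1[mod p ]) where
    open ≡-Reasoning

    private
      t = quotient k≡1
      k≡1+p*t = equality k≡1

    vertex-count≡1 : Fin n → n ≡1[mod p ]
    vertex-count≡1 u = ≡1-by (t * k) (+-cancelˡ-≡ k n (1 + p * (t * k)) (begin
      k + n                      ≡⟨ vertex-count u ⟨
      k * k + 1                  ≡⟨ cong (λ c → c * k + 1) k≡1+p*t ⟩
      (1 + p * t) * k + 1        ≡⟨ lemma p t k ⟩
      k + (1 + p * (t * k))      ∎))
      where
      lemma : ∀ p t k → (1 + p * t) * k + 1 ≡ k + (1 + p * (t * k))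
      lemma = solve 3 (λ p t k → (con 1 :+ p :* t) :* k :+ con 1 := k :+ (con 1 :+ p :* (t :* k))) refl

    closed-walks≡1 : ∀ m u → walks (2 + m) u u ≡1[mod p ]
    closed-walks≡1 m u = subst (_≡1[mod p ]) (sym W₂≡) (≡1-+* (≡1-^ k≡1 m) (t * walks m u u))
      where
      W₂≡ : walks (2 + m) u u ≡ k ^ m + p * (t * walks m u u)
      W₂≡ = +-cancelʳ-≡ (walks m u u) _ _ (begin
        walks (2 + m) u u + walks m u u                  ≡⟨ walks-recurrence m u u ⟩
        k * walks m u u + k ^ m                          ≡⟨ cong (λ c → c * walks m u u + k ^ m) k≡1+p*t ⟩
        (1 + p * t) * walks m u u + k ^ m                ≡⟨ lemma p t (walks m u u) (k ^ m) ⟩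
        k ^ m + p * (t * walks m u u) + walks m u u      ∎)
        where
        lemma : ∀ p t w q → (1 + p * t) * w + q ≡ q + p * (t * w) + w
        lemma = solve 4 (λ p t w q → (con 1 :+ p :* t) :* w :+ q := q :+ p :* (t :* w) :+ w) refl

    all-closed-walks≡1 : Fin n → ∀ m → ∑ₑ[ u ] walks (2 + m) u u ≡1[mod p ]
    all-closed-walks≡1 u m =
      ∑-≡1 elements (subst (_≡1[mod p ]) (sym (Listₚ.length-tabulate id)) (vertex-count≡1 u)) (closed-walks≡1 m)

  -- Rotation acts on closed walks of prime length p without fixed points, so p divides their number.
  k≢1[mod-prime] : Fin n → ∀ {p} → Prime p → ¬ (k ≡1[mod p ])
  k≢1[mod-prime] u {suc (suc r)} p-prime k≡1 =
    prime∤1 p-prime (≡1∧∣⇒∣1 (all-closed-walks≡1 k≡1 u r) p∣closed-walks)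
    where
    open OrbitCounting (Vec-enumeration (Fin-enumeration n) (2 + r)) rotate p-prime rotate-period using (p∣∑)
    p∣closed-walks : 2 + r ∣ ∑ₑ[ u ] walks (2 + r) u u
    p∣closed-walks = subst (2 + r ∣_) (∑-closed-walk-weight (suc r))
      (p∣∑ closed-walk-weight closed-walk-weight-rotate closed-walk-weight-fixed)

vertex-count⇒≤3 : ∀ {k n} → k ≤ 2 → k * k + 1 ≡ k + n → n ≤ 3
vertex-count⇒≤3 {k} {n} k≤2 k*k+1≡k+n = +-cancelˡ-≤ k n 3 (subst (_≤ k + 3) k*k+1≡k+n (bound k≤2))
  where
  bound : ∀ {k} → k ≤ 2 → k * k + 1 ≤ k + 3
  bound z≤n             = s≤s z≤n
  bound (s≤s z≤n)       = s≤s (s≤s z≤n)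
  bound (s≤s (s≤s z≤n)) = ≤-refl

friendship-theorem : ∀ {n} (G : Graph n) → IsFriendshipGraph G → (∀ v → ¬ Universal G v) → n ≤ 3
friendship-theorem {zero}  G _       _          = z≤n
friendship-theorem {suc n} G friends ¬universal =
  vertex-count⇒≤3 (≢1-mod-primes⇒≤2 (degree zero) (k≢1[mod-prime] zero)) (vertex-count zero)
  where
  open GraphCounting G using (degree)
  open Friendship G friends using (no-universal⇒regular)
  open RegularFriendship G friends (degree zero) (λ u → no-universal⇒regular ¬universal u zero)

-- Connectivity

∃-avoiding : ∀ {n} (xs : List (Fin n)) → length xs < n → ∃ λ z → All (z ≢_) xs
∃-avoiding {n} xs |xs|<n =
  map₂ (¬Any⇒All¬ xs) (¬∀⟶∃¬ n (λ z → Any (z ≡_) xs) (λ z → Any.any? (z Fin.≟_) xs) not-all-listed)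
  where
  not-all-listed : ¬ (∀ z → Any (z ≡_) xs)
  not-all-listed listed with i , j , i<j , same-index ← pigeonhole |xs|<n (λ z → Any.index (listed z)) =
    Finₚ.<⇒≢ i<j (begin
      i                                   ≡⟨ lookup-index (listed i) ⟩
      lookup xs (Any.index (listed i))    ≡⟨ cong (lookup xs) same-index ⟩
      lookup xs (Any.index (listed j))    ≡⟨ lookup-index (listed j) ⟨
      j                                   ∎)
    where open ≡-Reasoning

module Connectivity {n : ℕ} (G : Graph n) where
  open GraphCounting G using (Adj-sym; Adj⇒≢)

  walk-start∉ : ∀ {S s t} → WalkAvoid G S s t → s ∉ S
  walk-start∉ (here s∉S)     = s∉S
  walk-start∉ (step s∉S _ _) = s∉S

  walk⇒neighbour∉ : ∀ {S s t} → s ≢ t → WalkAvoid G S s t → ∃ λ x → Adj G s x × x ∉ S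
  walk⇒neighbour∉ s≢s (here _)           = contradiction refl s≢s
  walk⇒neighbour∉ _   (step _ s~x rest) = _ , s~x , walk-start∉ rest

  3-connected⇒no-cut-vertex : KConnected 3 G → NoCutVertex G
  3-connected⇒no-cut-vertex (_ , connected) v =
    connected ⁅ v ⁆ (subst (λ c → suc c ≤ 3) (sym (∣⁅x⁆∣≡1 v)) (s≤s (s≤s z≤n)))

  neighbour-avoiding : NoCutVertex G → ∀ {z w t} → z ≢ w → t ≢ z → t ≢ w → ∃ λ x → Adj G z x × x ≢ w
  neighbour-avoiding no-cut {z} {w} {t} z≢w t≢z t≢w
    with x , z~x , x∉⁅w⁆ ← walk⇒neighbour∉ (t≢z ∘ sym) (no-cut w z t (x≢y⇒x∉⁅y⁆ z≢w) (x≢y⇒x∉⁅y⁆ t≢w)) =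
    x , z~x , x∉⁅y⁆⇒x≢y x∉⁅w⁆

  two-neighbours : 3 ≤ n → NoCutVertex G → ∀ z → ∃₂ λ x y → x ≢ y × Adj G z x × Adj G z y
  two-neighbours 3≤n no-cut z
    with w  , w≢z ∷ []          ← ∃-avoiding (z ∷ []) (≤-trans (s≤s (s≤s z≤n)) 3≤n)
    with t  , t≢z ∷ t≢w ∷ []    ← ∃-avoiding (z ∷ w ∷ []) 3≤n
    with x  , z~x , _           ← neighbour-avoiding no-cut (w≢z ∘ sym) t≢z t≢w
    with t′ , t′≢z ∷ t′≢x ∷ []  ← ∃-avoiding (z ∷ x ∷ []) 3≤n
    with y  , z~y , y≢x         ← neighbour-avoiding no-cut (Adj⇒≢ z~x) t′≢z t′≢x
    = x , y , y≢x ∘ sym , z~x , z~y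

  module _ (friends : IsFriendshipGraph G) {v : Fin n} (universal : Universal G v) {x : Fin n} (x≢v : x ≢ v) where
    open Friendship G friends using (unique; meet; meet-adj)

    private
      y = meet x v
      x~y = proj₁ (meet-adj x≢v)
      v~y = proj₂ (meet-adj x≢v)

    -- In G − v each vertex has at most one neighbour, as any two would be common neighbours with v.
    step-stays : ∀ {s s′} → s ≡ x ⊎ s ≡ y → Adj G s s′ → s′ ≢ v → s′ ≡ x ⊎ s′ ≡ y
    step-stays (inj₁ refl) x~s′ s′≢v = inj₂ (unique x≢v x~s′ (universal s′≢v) x~y v~y)
    step-stays (inj₂ refl) y~s′ s′≢v = inj₁ (unique (Adj⇒≢ v~y ∘ sym) y~s′ (universal s′≢v) (Adj-sym x~y) (universal x≢v))

    walk-stays : ∀ {s t} → WalkAvoid G ⁅ v ⁆ s t → s ≡ x ⊎ s ≡ y → t ≡ x ⊎ t ≡ y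
    walk-stays (here _)            s∈ = s∈
    walk-stays (step _ s~s′ rest) s∈ = walk-stays rest (step-stays s∈ s~s′ (x∉⁅y⁆⇒x≢y (walk-start∉ rest)))

  universal⇒cut-vertex : 4 ≤ n → IsFriendshipGraph G → ∀ {v} → Universal G v → ¬ ConnectedWithout G ⁅ v ⁆
  universal⇒cut-vertex 4≤n friends {v} universal connected
    with x , x≢v ∷ []                 ← ∃-avoiding (v ∷ []) (≤-trans (s≤s (s≤s z≤n)) 4≤n)
    with z , z≢v ∷ z≢x ∷ z≢y ∷ []     ← ∃-avoiding (v ∷ x ∷ Friendship.meet G friends x v ∷ []) 4≤n
    with walk-stays friends universal x≢v (connected x z (x≢y⇒x∉⁅y⁆ x≢v) (x≢y⇒x∉⁅y⁆ z≢v)) (inj₁ refl)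
  ... | inj₁ z≡x = z≢x z≡x
  ... | inj₂ z≡y = z≢y z≡y

-- Graphs without 4-cycles

InA? : ∀ {n} (G : Graph n) a → Dec (InA G a)
InA? G a = any? λ u → any? λ v → ¬? (u Fin.≟ v) ×-dec (commonNbrs G u v ℕ.≟ a)

module C4Free {n : ℕ} (G : Graph n) (4≤n : 4 ≤ n) (no-cut : NoCutVertex G) (C4-free : ¬ HasC4 G) where
  open GraphCounting G
  open Connectivity G

  commonNbrs≤1 : ∀ {u v} → u ≢ v → commonNbrs G u v ≤ 1
  commonNbrs≤1 {u} {v} u≢v =
    subst (_≤ 1) (sym (commonNbrs≡common u v)) (unique⇒common≤1 (C4-free⇒unique C4-free) u≢v)

  1∈A : InA G 1
  1∈A =
    let x , y , x≢y , z~x , z~y = two-neighbours (≤-trans (n≤1+n 3) 4≤n) no-cut (Fin.fromℕ< (≤-trans (s≤s z≤n) 4≤n))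
    in  x , y , x≢y , ≤-antisym (commonNbrs≤1 x≢y)
                        (subst (1 ≤_) (sym (commonNbrs≡common x y)) (common≥1 (Adj-sym z~x) (Adj-sym z~y)))

  -- Otherwise G is a friendship graph, whose universal vertex would be a cut vertex.
  0∈A : InA G 0
  0∈A = decidable-stable (InA? G 0) λ 0∉A →
    let friends : IsFriendshipGraph G
        friends u≢v = [ (λ ≡0 → contradiction (_ , _ , u≢v , ≡0) 0∉A) , id ]′ (n≤1⇒n≡0∨n≡1 (commonNbrs≤1 u≢v))
    in <⇒≱ 4≤n (friendship-theorem G friends λ v universal → universal⇒cut-vertex 4≤n friends universal (no-cut v))

  A⊆01 : ∀ {a} → InA G a → a ≡ 0 ⊎ a ≡ 1
  A⊆01 (u , v , u≢v , refl) = n≤1⇒n≡0∨n≡1 (commonNbrs≤1 u≢v)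

  01⊆A : ∀ {a} → a ≡ 0 ⊎ a ≡ 1 → InA G a
  01⊆A (inj₁ refl) = 0∈A
  01⊆A (inj₂ refl) = 1∈A

  C4-free⇒AIs01 : AIs01 G
  C4-free⇒AIs01 a = A⊆01 , 01⊆A

corollary3p7 : ∀ {n} (G : Graph n) → Polyhedron G → (AIs01 G ⇔ (¬ HasC4 G))
corollary3p7 G (_ , 3-connected@(4≤n , _)) = mk⇔
  (GraphCounting.AIs01⇒C4-free G)
  (C4Free.C4-free⇒AIs01 G 4≤n (Connectivity.3-connected⇒no-cut-vertex G 3-connected))
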